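{- Every weighted tournament whose weights all have the same parity is inducible by a preference profile that is $2$-dimensional Euclidean under the norm $\ell_2$. Every weighted bipartite tournament whose weights are all even is inducible by a preference profile that is $2$-dimensional Euclidean under the norm $\ell_1$, and also by a preference profile that is $2$-dimensional Euclidean under the norm $\ell_\infty$.
   Context: A weighted tournament on a finite node set $N=\{u_1,\dots,u_n\}$ assigns to each pair $\{u_i,u_j\}$ of distinct nodes either an arc in one direction, say $(u_i,u_j)$, with a positive integer weight $w(u_i,u_j)>0$, or no arc, in which case $w(u_i,u_j)=w(u_j,u_i)=0$; by convention $w(u_j,u_i)=-w(u_i,u_j)$. "All weights have the same parity" refers to all values $w(u_i,u_j)$ over all pairs (including the zero ones). A weighted tournament is bipartite if its underlying digraph is bipartite. A preference profile consists of a set $C$ of candidates and a finite set $V$ of voters (identical copies allowed), each voter $v$ having a strict total order $>_v$ on $C$. The weighted tournament is inducible by a profile if there is a profile with candidate set $C=\{c_1,\dots,c_n\}$ such that for every pair, $w(u_i,u_j)=|\{v\in V: c_i>_v c_j\}|-|\{v\in V: c_j>_v c_i\}|$. For $p\in\{1,2,\infty\}$ and points of $\mathbb{R}^2$, $d_1(x,y)=|x_1-y_1|+|x_2-y_2|$, $d_2(x,y)=\sqrt{(x_1-y_1)^2+(x_2-y_2)^2}$, $d_\infty(x,y)=\max(|x_1-y_1|,|x_2-y_2|)$. A profile is $2$-dimensional Euclidean under $\ell_p$ if there is a mapping $h: C\cup V\to\mathbb{R}^2$ such that for every voter $v$ and distinct candidates $c_i,c_j$: $c_i>_v c_j$ iff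 $d_p(h(v),h(c_i))<d_p(h(v),h(c_j))$. -}

module Defs where

open import Data.Nat using (ℕ; zero; suc)
open import Data.Bool using (Bool; true; false)
open import Data.Fin using (Fin; zero; suc) renaming (_<_ to _<ᶠ_)
open import Data.Fin.Properties using () renaming (_<?_ to _<ᶠ?_)
open import Data.Fin.Permutation using (Permutation′; _⟨$⟩ʳ_)
open import Data.Integer as ℤ using (ℤ)
open import Data.Integer.Divisibility using () renaming (_∣_ to _∣ℤ_)
open import Data.Rational as ℚ using (ℚ)
open import Data.Product using (Σ; ∃; _×_; _,_; proj₁; proj₂)
open import Relation.Nullary using (¬_; Dec; yes; no)
open import Relation.Binary.PropositionalEquality using (_≡_; _≢_)
open import Function.Bundles using (_⇔_)

-- A weighted tournament on nodes u_1..u_n (indexed by Fin n): an integer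
-- weight w i j for each ordered pair with w j i = - w i j.
-- w i j > 0 means an arc (u_i,u_j) of weight w i j; w i j = 0 means no arc.
record WTournament (n : ℕ) : Set where
  field
    w    : Fin n → Fin n → ℤ
    anti : ∀ i j → w j i ≡ ℤ.- w i j
open WTournament public

SameParity : ∀ {n} → WTournament n → Set
SameParity T = ∀ i j k l → i ≢ j → k ≢ l →
  ℤ.+ 2 ∣ℤ (w T i j ℤ.- w T k l)

AllEven : ∀ {n} → WTournament n → Set
AllEven T = ∀ i j → ℤ.+ 2 ∣ℤ w T i j

Bipartite : ∀ {n} → WTournament n → Set
Bipartite {n} T = Σ (Fin n → Bool) λ side →
  ∀ i j → w T i j ≢ ℤ.+ 0 → side i ≢ side j

-- A strict total order on the candidates c_1..c_n, given by a ranking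
-- (bijection candidates → positions); position 0 is the most preferred.
Ranking : ℕ → Set
Ranking n = Permutation′ n

Prefers : ∀ {n} → Ranking n → Fin n → Fin n → Set
Prefers r i j = (r ⟨$⟩ʳ i) <ᶠ (r ⟨$⟩ʳ j)

record Profile (n : ℕ) : Set where
  field
    m     : ℕ
    voter : Fin m → Ranking n
open Profile public

count : ∀ {m} {P : Fin m → Set} → (∀ k → Dec (P k)) → ℕ
count {zero}  P? = 0
count {suc m} P? with P? zero
... | yes _ = suc (count (λ k → P? (suc k)))
... | no  _ = count (λ k → P? (suc k))

supporters : ∀ {n} (P : Profile n) → Fin n → Fin n → ℕ
supporters P i j =
  count {P = λ v → Prefers (voter P v) i j}
        (λ v → (voter P v ⟨$⟩ʳ i) <ᶠ? (voter P v ⟨$⟩ʳ j))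

Induces : ∀ {n} → Profile n → WTournament n → Set
Induces P T = ∀ i j →
  w T i j ≡ ℤ.+ (supporters P i j) ℤ.- ℤ.+ (supporters P j i)

Point : Set
Point = ℚ × ℚ

data Norm : Set where
  ℓ₁ ℓ₂ ℓ∞ : Norm

-- Distance used for comparisons. For ℓ₂ we use the squared Euclidean
-- distance, which induces the same strict comparisons as d₂.
dist : Norm → Point → Point → ℚ
dist ℓ₁ (x₁ , x₂) (y₁ , y₂) = ℚ.∣ x₁ ℚ.- y₁ ∣ ℚ.+ ℚ.∣ x₂ ℚ.- y₂ ∣
dist ℓ₂ (x₁ , x₂) (y₁ , y₂) =
  ((x₁ ℚ.- y₁) ℚ.* (x₁ ℚ.- y₁)) ℚ.+ ((x₂ ℚ.- y₂) ℚ.* (x₂ ℚ.- y₂))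
dist ℓ∞ (x₁ , x₂) (y₁ , y₂) = ℚ.∣ x₁ ℚ.- y₁ ∣ ℚ.⊔ ℚ.∣ x₂ ℚ.- y₂ ∣

Euclidean2 : ∀ {n} → Norm → Profile n → Set
Euclidean2 {n} p P =
  Σ (Fin n → Point) λ hc → Σ (Fin (m P) → Point) λ hv →
    ∀ v i j → i ≢ j →
      Prefers (voter P v) i j ⇔ (dist p (hv v) (hc i) ℚ.< dist p (hv v) (hc j))

InducibleEuclidean : ∀ {n} → Norm → WTournament n → Set
InducibleEuclidean {n} p T = Σ (Profile n) λ P → Induces P T × Euclidean2 p P

-- A weighted tournament with even weights is a sum of pair gadgets (McGarvey): two voters
-- that both rank a above b but disagree on every other pair add 2 to the margin of (a, b)
-- and nothing elsewhere. If all weights are odd, subtracting the votes of a single voter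
-- makes them even. So it suffices to realise pair gadgets with integer coordinates.
--
-- Under ℓ₂ put candidate k at (2ᵏ, 4ᵏ) on the parabola y = x². The squared distances from
-- a voter to candidates i and j differ by (2ⁱ − 2ʲ) times an affine function of the voter,
-- so two voters far out on either side of the chord from a to b, along its normal,
-- disagree on every pair whose chord has another slope; and distinct pairs have distinct
-- slopes 2ⁱ + 2ʲ. Shifting both voters slightly towards a breaks the tie on (a, b).
--
-- Under ℓ₁ put the two classes of a bipartite tournament on two vertical lines. A voter
-- above all candidates and one below them disagree on every same-side pair; their
-- horizontal positions are chosen so that every cross pair other than (a, b) is decided
-- by the same powers-of-two argument. Rotating the plane by 45° turns ℓ₁ into ℓ∞.
module Submission where

open import Defs
open import Data.Bool.Base using (Bool; true; false)
open import Data.Fin.Base as Fin using (Fin; zero; suc; toℕ; fromℕ<; punchIn; punchOut)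
import Data.Fin.Properties as Fin
open import Data.Fin.Permutation using (permutation; _⟨$⟩ʳ_)
open import Data.Integer.Base as ℤ
  using (ℤ; +_; -[1+_]; +[1+_]; 0ℤ; 1ℤ; _+_; _-_; _*_; -_; _≤_; _<_; _⊔_; +≤+; +<+; -<+)
import Data.Integer.Properties as ℤ
open import Data.Integer.DivMod using (_%ℕ_; _/ℕ_; n%ℕd<d; a≡a%ℕn+[a/ℕn]*n)
open import Data.Integer.Divisibility using () renaming (_∣_ to _∣ℤ_)
open import Data.Integer.Divisibility.Signed
  using (_∣_; divides; ∣-refl; ∣m∣n⇒∣m+n; ∣m∣n⇒∣m-n; ∣ᵤ⇒∣; ∣⇒∣ᵤ)
open import Data.Integer.Tactic.RingSolver using (solve-∀)
open import Data.List.Base using (List; []; _∷_; _++_; length; lookup; concat; replicate; tabulate)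
open import Data.Nat.Base as ℕ using (ℕ; zero; suc; z≤n; s≤s; _^_)
import Data.Nat.Properties as ℕ
import Data.Nat.DivMod as ℕ
open import Data.Nat.Divisibility as ℕ using ()
open import Data.Product.Base using (Σ; ∃; _×_; _,_; proj₁; proj₂)
open import Data.Rational.Base as ℚ using (ℚ; *<*; *≤*)
import Data.Rational.Properties as ℚ
open import Data.Rational.Literals using (fromℤ)
import Data.Rational.Unnormalised.Base as ℚᵘ
import Data.Rational.Unnormalised.Properties as ℚᵘ
open import Data.Sum.Base using (_⊎_; inj₁; inj₂)
open import Data.Unit.Base using (tt)
open import Function.Base using (_∘_)
open import Function.Bundles using (_⇔_; mk⇔; Equivalence)
open import Function.Definitions using (Injective)
open import Relation.Binary.Definitions using (tri<; tri≈; tri>)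
open import Relation.Binary.PropositionalEquality
open import Relation.Nullary.Decidable using (Dec; yes; no)
open import Relation.Nullary.Negation using (¬_; contradiction)
open import Algebra.Properties.CommutativeMonoid.Sum ℤ.+-0-commutativeMonoid
  using (sum; sum-cong-≗; sum-remove; sum-replicate-zero)

0<i-j⇒j<i : ∀ {i j} → 0ℤ < i - j → j < i
0<i-j⇒j<i {i} {j} 0<i-j = subst₂ _<_ (ℤ.+-identityʳ j) (j+[i-j]≡i i j) (ℤ.+-monoʳ-< j 0<i-j)
  where
  j+[i-j]≡i : ∀ i j → j + (i - j) ≡ i
  j+[i-j]≡i = solve-∀

i-j<0⇒i<j : ∀ {i j} → i - j < 0ℤ → i < j
i-j<0⇒i<j {i} {j} i-j<0 = 0<i-j⇒j<i (subst (0ℤ <_) (-[i-j]≡j-i i j) (ℤ.neg-mono-< i-j<0))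
  where
  -[i-j]≡j-i : ∀ i j → - (i - j) ≡ j - i
  -[i-j]≡j-i = solve-∀

i<j⇒0<j-i : ∀ {i j} → i < j → 0ℤ < j - i
i<j⇒0<j-i {i} {j} i<j = subst (_< j - i) (ℤ.+-inverseʳ i) (ℤ.+-monoˡ-< (- i) i<j)

i<j⇒i-j<0 : ∀ {i j} → i < j → i - j < 0ℤ
i<j⇒i-j<0 {i} {j} i<j = subst (_< 0ℤ) (-[j-i]≡i-j i j) (ℤ.neg-mono-< (i<j⇒0<j-i i<j))
  where
  -[j-i]≡i-j : ∀ i j → - (j - i) ≡ i - j
  -[j-i]≡i-j = solve-∀

<-by-difference : ∀ {i j} e → j - i ≡ e → 0ℤ < e → i < j
<-by-difference e j-i≡e 0<e = 0<i-j⇒j<i (subst (0ℤ <_) (sym j-i≡e) 0<e)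

*-pos-pos : ∀ {i j} → 0ℤ < i → 0ℤ < j → 0ℤ < i * j
*-pos-pos (+<+ (s≤s _)) (+<+ (s≤s _)) = +<+ (s≤s z≤n)

*-pos-neg : ∀ {i j} → 0ℤ < i → j < 0ℤ → i * j < 0ℤ
*-pos-neg (+<+ (s≤s _)) -<+ = -<+

*-neg-pos : ∀ {i j} → i < 0ℤ → 0ℤ < j → i * j < 0ℤ
*-neg-pos -<+ (+<+ (s≤s _)) = -<+

*-neg-neg : ∀ {i j} → i < 0ℤ → j < 0ℤ → 0ℤ < i * j
*-neg-neg -<+ -<+ = +<+ (s≤s z≤n)

*-nonNeg : ∀ {i j} → 0ℤ ≤ i → 0ℤ ≤ j → 0ℤ ≤ i * j
*-nonNeg {+ m} {+ k} _ _ = subst (0ℤ ≤_) (ℤ.pos-* m k) (+≤+ z≤n)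

OppositeSigns : ℤ → ℤ → Set
OppositeSigns i j = (0ℤ < i × j < 0ℤ) ⊎ (i < 0ℤ × 0ℤ < j)

opposite-signs-*ˡ : ∀ {d i j} → d ≢ 0ℤ → OppositeSigns i j → OppositeSigns (d * i) (d * j)
opposite-signs-*ˡ {d} d≢0 ij with ℤ.<-cmp d 0ℤ | ij
... | tri≈ _ d≡0 _ | _                 = contradiction d≡0 d≢0
... | tri> _ _ 0<d | inj₁ (0<i , j<0) = inj₁ (*-pos-pos 0<d 0<i , *-pos-neg 0<d j<0)
... | tri> _ _ 0<d | inj₂ (i<0 , 0<j) = inj₂ (*-pos-neg 0<d i<0 , *-pos-pos 0<d 0<j)
... | tri< d<0 _ _ | inj₁ (0<i , j<0) = inj₂ (*-neg-pos d<0 0<i , *-neg-neg d<0 j<0)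
... | tri< d<0 _ _ | inj₂ (i<0 , 0<j) = inj₁ (*-neg-neg d<0 i<0 , *-neg-pos d<0 0<j)

opposite-signs⇒*<0 : ∀ {i j} → OppositeSigns i j → i * j < 0ℤ
opposite-signs⇒*<0 (inj₁ (0<i , j<0)) = *-pos-neg 0<i j<0
opposite-signs⇒*<0 (inj₂ (i<0 , 0<j)) = *-neg-pos i<0 0<j

Bounded : ℤ → ℤ → Set
Bounded M g = - M < g × g < M

dominant-pos : ∀ {M g z} → 0ℤ ≤ M → - M < g → 0ℤ < z → 0ℤ < M * z + g
dominant-pos {M} {g} {z} 0≤M -M<g 0<z =
  subst (0ℤ <_) (sym (split M g z))
    (ℤ.+-mono-≤-< (*-nonNeg 0≤M (ℤ.i≤j⇒0≤j-i (ℤ.i<j⇒suc[i]≤j 0<z))) (i<j⇒0<j-i -M<g))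
  where
  split : ∀ M g z → M * z + g ≡ M * (z - 1ℤ) + (g - - M)
  split = solve-∀

dominant-neg : ∀ {M g z} → 0ℤ ≤ M → g < M → z < 0ℤ → M * z + g < 0ℤ
dominant-neg {M} {g} {z} 0≤M g<M z<0 =
  subst (_< 0ℤ) (negate M g z) (ℤ.neg-mono-< (dominant-pos 0≤M (ℤ.neg-mono-< g<M) (ℤ.neg-mono-< z<0)))
  where
  negate : ∀ M g z → - (M * (- z) + - g) ≡ M * z + g
  negate = solve-∀

opposite-signs-dominant : ∀ {M g h z} → 0ℤ ≤ M → Bounded M g → Bounded M h → z ≢ 0ℤ →
  OppositeSigns (M * z + g) (M * (- z) + h)
opposite-signs-dominant {z = z} 0≤M (-M<g , g<M) (-M<h , h<M) z≢0 with ℤ.<-cmp z 0ℤ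
... | tri< z<0 _ _ = inj₂ (dominant-neg 0≤M g<M z<0 , dominant-pos 0≤M -M<h (ℤ.neg-mono-< z<0))
... | tri≈ _ z≡0 _ = contradiction z≡0 z≢0
... | tri> _ _ 0<z = inj₁ (dominant-pos 0≤M -M<g 0<z , dominant-neg 0≤M h<M (ℤ.neg-mono-< 0<z))

+[m/2]*2≡+m : ∀ {m} → 2 ℕ.∣ m → + (m ℕ./ 2) * + 2 ≡ + m
+[m/2]*2≡+m {m} 2∣m = trans (sym (ℤ.pos-* (m ℕ./ 2) 2)) (cong +_ (ℕ.m/n*n≡m 2∣m))

half⁺ : ℤ → ℕ
half⁺ (+ m)    = m ℕ./ 2
half⁺ -[1+ _ ] = 0

half⁺-split : ∀ z → 2 ℕ.∣ ℤ.∣ z ∣ → + half⁺ z * + 2 + + half⁺ (- z) * - + 2 ≡ z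
half⁺-split (+ zero)  _   = refl
half⁺-split +[1+ m ]  2∣z = trans (ℤ.+-identityʳ _) (+[m/2]*2≡+m 2∣z)
half⁺-split -[1+ m ]  2∣z = trans (ℤ.+-identityˡ _)
  (trans (sym (ℤ.neg-distribʳ-* (+ (suc m ℕ./ 2)) (+ 2))) (cong -_ (+[m/2]*2≡+m 2∣z)))

even⊎odd : ∀ z → + 2 ∣ z ⊎ + 2 ∣ z + 1ℤ
even⊎odd z with z %ℕ 2 | n%ℕd<d z 2 | a≡a%ℕn+[a/ℕn]*n z 2
... | 0           | _            | z≡2q   = inj₁ (divides (z /ℕ 2) (trans z≡2q (ℤ.+-identityˡ _)))
... | 1           | _            | z≡1+2q =
  inj₂ (divides (z /ℕ 2 + 1ℤ) (trans (cong (_+ 1ℤ) z≡1+2q) (shift (z /ℕ 2))))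
  where
  shift : ∀ q → (1ℤ + q * + 2) + 1ℤ ≡ (q + 1ℤ) * + 2
  shift = solve-∀
... | suc (suc _) | s≤s (s≤s ()) | _

odd-minus-±1 : ∀ {z s} → + 2 ∣ z + 1ℤ → s ≡ 1ℤ ⊎ s ≡ - 1ℤ → + 2 ∣ z - s
odd-minus-±1 {z} 2∣z+1 (inj₁ refl) = subst (+ 2 ∣_) (shift z) (∣m∣n⇒∣m-n 2∣z+1 ∣-refl)
  where
  shift : ∀ z → (z + 1ℤ) - + 2 ≡ z - 1ℤ
  shift = solve-∀
odd-minus-±1 2∣z+1 (inj₂ refl) = 2∣z+1

count-mono-≤ : ∀ {m} {P Q : Fin m → Set} (P? : ∀ k → Dec (P k)) (Q? : ∀ k → Dec (Q k)) →
  (∀ k → P k → Q k) → count P? ℕ.≤ count Q?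
count-mono-≤ {zero}  P? Q? P⊆Q = z≤n
count-mono-≤ {suc m} P? Q? P⊆Q with P? zero | Q? zero
... | yes _ | yes _ = s≤s (count-mono-≤ (P? ∘ suc) (Q? ∘ suc) (P⊆Q ∘ suc))
... | yes p | no ¬q = contradiction (P⊆Q zero p) ¬q
... | no _  | yes _ = ℕ.m≤n⇒m≤1+n (count-mono-≤ (P? ∘ suc) (Q? ∘ suc) (P⊆Q ∘ suc))
... | no _  | no _  = count-mono-≤ (P? ∘ suc) (Q? ∘ suc) (P⊆Q ∘ suc)

count-mono-< : ∀ {m} {P Q : Fin m → Set} (P? : ∀ k → Dec (P k)) (Q? : ∀ k → Dec (Q k)) →
  (∀ k → P k → Q k) → ∀ k → ¬ P k → Q k → count P? ℕ.< count Q?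
count-mono-< {suc m} P? Q? P⊆Q k ¬pₖ qₖ with P? zero | Q? zero | k
... | yes p | _     | zero  = contradiction p ¬pₖ
... | no _  | yes _ | zero  = s≤s (count-mono-≤ (P? ∘ suc) (Q? ∘ suc) (P⊆Q ∘ suc))
... | no _  | no ¬q | zero  = contradiction qₖ ¬q
... | yes p | no ¬q | suc _ = contradiction (P⊆Q zero p) ¬q
... | yes _ | yes _ | suc k = s≤s (count-mono-< (P? ∘ suc) (Q? ∘ suc) (P⊆Q ∘ suc) k ¬pₖ qₖ)
... | no _  | yes _ | suc k = ℕ.m≤n⇒m≤1+n (count-mono-< (P? ∘ suc) (Q? ∘ suc) (P⊆Q ∘ suc) k ¬pₖ qₖ)
... | no _  | no _  | suc k = count-mono-< (P? ∘ suc) (Q? ∘ suc) (P⊆Q ∘ suc) k ¬pₖ qₖ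

count-all : ∀ {m} {P : Fin m → Set} (P? : ∀ k → Dec (P k)) → (∀ k → P k) → count P? ≡ m
count-all {zero}  P? all = refl
count-all {suc m} P? all with P? zero
... | yes _ = cong suc (count-all (P? ∘ suc) (all ∘ suc))
... | no ¬p = contradiction (all zero) ¬p

count-< : ∀ {m} {P : Fin m → Set} (P? : ∀ k → Dec (P k)) → ∀ k → ¬ P k → count P? ℕ.< m
count-< {m} P? k ¬pₖ = subst (count P? ℕ.<_) (count-all {m} (λ _ → yes tt) (λ _ → tt))
  (count-mono-< P? (λ _ → yes tt) (λ _ _ → tt) k ¬pₖ tt)

indicator : {A : Set} → Dec A → ℕ
indicator (yes _) = 1
indicator (no _)  = 0

indicator-cong : {A B : Set} → A ⇔ B → (a? : Dec A) (b? : Dec B) → indicator a? ≡ indicator b?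
indicator-cong _   (yes _) (yes _) = refl
indicator-cong A⇔B (yes a) (no ¬b) = contradiction (Equivalence.to A⇔B a) ¬b
indicator-cong A⇔B (no ¬a) (yes b) = contradiction (Equivalence.from A⇔B b) ¬a
indicator-cong _   (no _)  (no _)  = refl

count-suc : ∀ {m} {P : Fin (suc m) → Set} (P? : ∀ k → Dec (P k)) →
  count P? ≡ indicator (P? zero) ℕ.+ count (P? ∘ suc)
count-suc P? with P? zero
... | yes _ = refl
... | no _  = refl

injective⇒surjective : ∀ {n} {f : Fin n → Fin n} → Injective _≡_ _≡_ f → ∀ y → ∃ λ x → f x ≡ y
injective⇒surjective {suc n} {f} f-injective y with Fin.any? (λ x → f x Fin.≟ y)
... | yes hit = hit
... | no miss = contradiction (Fin.injective⇒≤ g-injective) ℕ.1+n≰n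
  where
  y≢f : ∀ x → y ≢ f x
  y≢f x y≡fx = miss (x , sym y≡fx)
  g : Fin (suc n) → Fin n
  g x = punchOut (y≢f x)
  g-injective : Injective _≡_ _≡_ g
  g-injective {x} {x′} = f-injective ∘ Fin.punchOut-injective (y≢f x) (y≢f x′)

module RankBy {n} (s : Fin n → ℤ) (s-injective : Injective _≡_ _≡_ s) where

  rank : Fin n → Fin n
  rank i = fromℕ< (count-< (λ k → s k ℤ.<? s i) i (ℤ.<-irrefl refl))

  rank-mono : ∀ {i j} → s i < s j → rank i Fin.< rank j
  rank-mono {i} {j} sᵢ<sⱼ = subst₂ ℕ._<_ (sym (Fin.toℕ-fromℕ< _)) (sym (Fin.toℕ-fromℕ< _))
    (count-mono-< (λ k → s k ℤ.<? s i) (λ k → s k ℤ.<? s j) (λ _ sₖ<sᵢ → ℤ.<-trans sₖ<sᵢ sᵢ<sⱼ)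
      i (ℤ.<-irrefl refl) sᵢ<sⱼ)

  rank-reflects : ∀ {i j} → rank i Fin.< rank j → s i < s j
  rank-reflects {i} {j} rᵢ<rⱼ with ℤ.<-cmp (s i) (s j)
  ... | tri< sᵢ<sⱼ _ _ = sᵢ<sⱼ
  ... | tri≈ _ sᵢ≡sⱼ _ = contradiction (cong (toℕ ∘ rank) (s-injective sᵢ≡sⱼ)) (ℕ.<⇒≢ rᵢ<rⱼ)
  ... | tri> _ _ sⱼ<sᵢ = contradiction rᵢ<rⱼ (ℕ.<-asym (rank-mono sⱼ<sᵢ))

  rank-injective : Injective _≡_ _≡_ rank
  rank-injective {i} {j} rᵢ≡rⱼ with ℤ.<-cmp (s i) (s j)
  ... | tri< sᵢ<sⱼ _ _ = contradiction (cong toℕ rᵢ≡rⱼ) (ℕ.<⇒≢ (rank-mono sᵢ<sⱼ))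
  ... | tri≈ _ sᵢ≡sⱼ _ = s-injective sᵢ≡sⱼ
  ... | tri> _ _ sⱼ<sᵢ = contradiction (cong toℕ (sym rᵢ≡rⱼ)) (ℕ.<⇒≢ (rank-mono sⱼ<sᵢ))

  ranking : Ranking n
  ranking = permutation rank (proj₁ ∘ onto) (proj₂ ∘ onto) (rank-injective ∘ proj₂ ∘ onto ∘ rank)
    where
    onto = injective⇒surjective rank-injective

  prefers⇔ : ∀ i j → Prefers ranking i j ⇔ s i < s j
  prefers⇔ i j = mk⇔ rank-reflects rank-mono

sum-zero : ∀ {n} (f : Fin n → ℤ) → (∀ k → f k ≡ 0ℤ) → sum f ≡ 0ℤ
sum-zero {n} f f≡0 = trans (sum-cong-≗ f≡0) (sum-replicate-zero n)

sum-pointMass : ∀ {n} (f : Fin n → ℤ) i → (∀ k → k ≢ i → f k ≡ 0ℤ) → sum f ≡ f i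
sum-pointMass {suc n} f i f≡0 = begin
  sum f                     ≡⟨ sum-remove {i = i} f ⟩
  f i + sum (f ∘ punchIn i) ≡⟨ cong (_+_ (f i)) (sum-zero (f ∘ punchIn i) (λ k → f≡0 _ (Fin.punchInᵢ≢i i k))) ⟩
  f i + 0ℤ                  ≡⟨ ℤ.+-identityʳ (f i) ⟩
  f i                       ∎
  where open ≡-Reasoning

sum-twoPoints : ∀ {n} (f : Fin n → ℤ) {i j} → i ≢ j → (∀ k → k ≢ i → k ≢ j → f k ≡ 0ℤ) →
  sum f ≡ f i + f j
sum-twoPoints {suc n} f {i} {j} i≢j f≡0 = begin
  sum f                              ≡⟨ sum-remove {i = i} f ⟩
  f i + sum (f ∘ punchIn i)          ≡⟨ cong (_+_ (f i)) (sum-pointMass (f ∘ punchIn i) (punchOut i≢j) off-j) ⟩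
  f i + f (punchIn i (punchOut i≢j)) ≡⟨ cong (λ k → f i + f k) (Fin.punchIn-punchOut i≢j) ⟩
  f i + f j                          ∎
  where
  open ≡-Reasoning
  off-j : ∀ k → k ≢ punchOut i≢j → f (punchIn i k) ≡ 0ℤ
  off-j k k≢ = f≡0 _ (Fin.punchInᵢ≢i i k) λ ↑k≡j →
    k≢ (Fin.punchIn-injective i _ _ (trans ↑k≡j (sym (Fin.punchIn-punchOut i≢j))))

w-diagonal : ∀ {n} (T : WTournament n) i → w T i i ≡ 0ℤ
w-diagonal T i = self-negation (w T i i) (anti T i i)
  where
  self-negation : ∀ z → z ≡ - z → z ≡ 0ℤ
  self-negation (+ zero) _  = refl
  self-negation +[1+ _ ] ()
  self-negation -[1+ _ ] ()

nonzero⇒off-diagonal : ∀ {n} (T : WTournament n) a b → w T a b ≢ 0ℤ → a ≢ b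
nonzero⇒off-diagonal T a _ wₐₐ≢0 refl = wₐₐ≢0 (w-diagonal T a)

diagonal-even : ∀ {n} (T : WTournament n) i → + 2 ∣ℤ w T i i
diagonal-even T i = subst (+ 2 ∣ℤ_) (sym (w-diagonal T i)) (ℕ.divides 0 refl)

same-parity-∣ : ∀ {n} (T : WTournament n) → SameParity T → ∀ {i j k l} → i ≢ j → k ≢ l →
  ∀ c → + 2 ∣ w T k l + c → + 2 ∣ w T i j + c
same-parity-∣ T same {i} {j} {k} {l} i≢j k≢l c 2∣wₖₗ+c =
  subst (+ 2 ∣_) (telescope (w T i j) (w T k l) c)
    (∣m∣n⇒∣m+n {i = + 2} {m = w T i j - w T k l} (∣ᵤ⇒∣ (same i j k l i≢j k≢l)) 2∣wₖₗ+c)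
  where
  telescope : ∀ x y c → (x - y) + (y + c) ≡ x + c
  telescope = solve-∀

SamePair : ∀ {n} → Fin n → Fin n → Fin n → Fin n → Set
SamePair a b i j = (a ≡ i × b ≡ j) ⊎ (a ≡ j × b ≡ i)

SamePair-swapˡ : ∀ {n} {a b i j : Fin n} → SamePair a b i j → SamePair b a i j
SamePair-swapˡ (inj₁ (a≡i , b≡j)) = inj₂ (b≡j , a≡i)
SamePair-swapˡ (inj₂ (a≡j , b≡i)) = inj₁ (b≡i , a≡j)

SamePair-swapʳ : ∀ {n} {a b i j : Fin n} → SamePair a b j i → SamePair a b i j
SamePair-swapʳ (inj₁ p) = inj₂ p
SamePair-swapʳ (inj₂ p) = inj₁ p

data Opposed {n} (f g : Fin n → ℤ) (i j : Fin n) : Set where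
  i-first : f i < f j → g j < g i → Opposed f g i j
  j-first : f j < f i → g i < g j → Opposed f g i j

opposed-sym : ∀ {n} {f g : Fin n → ℤ} {i j} → Opposed f g i j → Opposed f g j i
opposed-sym (i-first fᵢ<fⱼ gⱼ<gᵢ) = j-first fᵢ<fⱼ gⱼ<gᵢ
opposed-sym (j-first fⱼ<fᵢ gᵢ<gⱼ) = i-first fⱼ<fᵢ gᵢ<gⱼ

opposed⇒≢ˡ : ∀ {n} {f g : Fin n → ℤ} {i j} → Opposed f g i j → f i ≢ f j
opposed⇒≢ˡ (i-first fᵢ<fⱼ _) = ℤ.<⇒≢ fᵢ<fⱼ
opposed⇒≢ˡ (j-first fⱼ<fᵢ _) = ℤ.<⇒≢ fⱼ<fᵢ ∘ sym

opposed⇒≢ʳ : ∀ {n} {f g : Fin n → ℤ} {i j} → Opposed f g i j → g i ≢ g j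
opposed⇒≢ʳ (i-first _ gⱼ<gᵢ) = ℤ.<⇒≢ gⱼ<gᵢ ∘ sym
opposed⇒≢ʳ (j-first _ gᵢ<gⱼ) = ℤ.<⇒≢ gᵢ<gⱼ

opposite-signs⇒opposed : ∀ {n} {f g : Fin n → ℤ} {i j} →
  OppositeSigns (f i - f j) (g i - g j) → Opposed f g i j
opposite-signs⇒opposed (inj₁ (0<Δf , Δg<0)) = j-first (0<i-j⇒j<i 0<Δf) (i-j<0⇒i<j Δg<0)
opposite-signs⇒opposed (inj₂ (Δf<0 , 0<Δg)) = i-first (i-j<0⇒i<j Δf<0) (0<i-j⇒j<i 0<Δg)

separating⇒injective : ∀ {n} {f : Fin n → ℤ} {a b} → f a ≢ f b →
  (∀ {i j} → i ≢ j → ¬ SamePair a b i j → f i ≢ f j) → Injective _≡_ _≡_ f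
separating⇒injective {f = f} fₐ≢f_b separates {i} {j} fᵢ≡fⱼ with i Fin.≟ j
... | yes i≡j = i≡j
... | no  i≢j = contradiction fᵢ≡fⱼ (separates i≢j λ
  { (inj₁ (refl , refl)) → fₐ≢f_b fᵢ≡fⱼ
  ; (inj₂ (refl , refl)) → fₐ≢f_b (sym fᵢ≡fⱼ) })

fromℤ-+ : ∀ i j → fromℤ i ℚ.+ fromℤ j ≡ fromℤ (i + j)
fromℤ-+ i j = ℚ.toℚᵘ-injective (ℚᵘ.≃-trans (ℚ.toℚᵘ-homo-+ (fromℤ i) (fromℤ j))
  (ℚᵘ.*≡* (cong (_* + 1) (cong₂ _+_ (ℤ.*-identityʳ i) (ℤ.*-identityʳ j)))))

fromℤ-* : ∀ i j → fromℤ i ℚ.* fromℤ j ≡ fromℤ (i * j)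
fromℤ-* i j = ℚ.toℚᵘ-injective (ℚᵘ.≃-trans (ℚ.toℚᵘ-homo-* (fromℤ i) (fromℤ j)) (ℚᵘ.*≡* refl))

fromℤ-neg : ∀ i → ℚ.- fromℤ i ≡ fromℤ (- i)
fromℤ-neg (+ zero) = refl
fromℤ-neg +[1+ _ ] = refl
fromℤ-neg -[1+ _ ] = refl

fromℤ-- : ∀ i j → fromℤ i ℚ.- fromℤ j ≡ fromℤ (i - j)
fromℤ-- i j = trans (cong (fromℤ i ℚ.+_) (fromℤ-neg j)) (fromℤ-+ i (- j))

fromℤ-mono-≤ : ∀ {i j} → i ≤ j → fromℤ i ℚ.≤ fromℤ j
fromℤ-mono-≤ {i} {j} i≤j = *≤* (subst₂ _≤_ (sym (ℤ.*-identityʳ i)) (sym (ℤ.*-identityʳ j)) i≤j)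

fromℤ-<⇔ : ∀ i j → (fromℤ i ℚ.< fromℤ j) ⇔ (i < j)
fromℤ-<⇔ i j = mk⇔ (λ { (*<* i<j) → subst₂ _<_ (ℤ.*-identityʳ i) (ℤ.*-identityʳ j) i<j })
                   (λ i<j → *<* (subst₂ _<_ (sym (ℤ.*-identityʳ i)) (sym (ℤ.*-identityʳ j)) i<j))

fromℤ-⊔ : ∀ i j → fromℤ i ℚ.⊔ fromℤ j ≡ fromℤ (i ⊔ j)
fromℤ-⊔ i j with ℤ.≤-total i j
... | inj₁ i≤j = trans (ℚ.p≤q⇒p⊔q≡q (fromℤ-mono-≤ i≤j)) (cong fromℤ (sym (ℤ.i≤j⇒i⊔j≡j i≤j)))
... | inj₂ j≤i = trans (ℚ.p≥q⇒p⊔q≡p (fromℤ-mono-≤ j≤i)) (cong fromℤ (sym (ℤ.i≥j⇒i⊔j≡i j≤i)))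

ℤ² : Set
ℤ² = ℤ × ℤ

distℤ : Norm → ℤ² → ℤ² → ℤ
distℤ ℓ₁ (x₁ , x₂) (y₁ , y₂) = + ℤ.∣ x₁ - y₁ ∣ + + ℤ.∣ x₂ - y₂ ∣
distℤ ℓ₂ (x₁ , x₂) (y₁ , y₂) = (x₁ - y₁) * (x₁ - y₁) + (x₂ - y₂) * (x₂ - y₂)
distℤ ℓ∞ (x₁ , x₂) (y₁ , y₂) = + ℤ.∣ x₁ - y₁ ∣ ⊔ + ℤ.∣ x₂ - y₂ ∣

fromℤ² : ℤ² → Point
fromℤ² (x₁ , x₂) = fromℤ x₁ , fromℤ x₂

dist-fromℤ² : ∀ p u v → dist p (fromℤ² u) (fromℤ² v) ≡ fromℤ (distℤ p u v)
dist-fromℤ² ℓ₁ (x₁ , x₂) (y₁ , y₂) rewrite fromℤ-- x₁ y₁ | fromℤ-- x₂ y₂ =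
  fromℤ-+ (+ ℤ.∣ x₁ - y₁ ∣) (+ ℤ.∣ x₂ - y₂ ∣)
dist-fromℤ² ℓ₂ (x₁ , x₂) (y₁ , y₂)
  rewrite fromℤ-- x₁ y₁ | fromℤ-- x₂ y₂ | fromℤ-* (x₁ - y₁) (x₁ - y₁) | fromℤ-* (x₂ - y₂) (x₂ - y₂) =
  fromℤ-+ ((x₁ - y₁) * (x₁ - y₁)) ((x₂ - y₂) * (x₂ - y₂))
dist-fromℤ² ℓ∞ (x₁ , x₂) (y₁ , y₂) rewrite fromℤ-- x₁ y₁ | fromℤ-- x₂ y₂ =
  fromℤ-⊔ (+ ℤ.∣ x₁ - y₁ ∣) (+ ℤ.∣ x₂ - y₂ ∣)

⊔-≡ˡ : ∀ {a b s} → a ≡ s → b ℕ.≤ s → a ℕ.⊔ b ≡ s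
⊔-≡ˡ refl b≤a = ℕ.m≥n⇒m⊔n≡m b≤a

⊔-≡ʳ : ∀ {a b s} → b ≡ s → a ℕ.≤ s → a ℕ.⊔ b ≡ s
⊔-≡ʳ refl a≤b = ℕ.m≤n⇒m⊔n≡n a≤b

∣i+j∣⊔∣i-j∣≡∣i∣+∣j∣ : ∀ i j → ℤ.∣ i + j ∣ ℕ.⊔ ℤ.∣ i - j ∣ ≡ ℤ.∣ i ∣ ℕ.+ ℤ.∣ j ∣
∣i+j∣⊔∣i-j∣≡∣i∣+∣j∣ i@(+ _)      j@(+ _)      = ⊔-≡ˡ refl (ℤ.∣i-j∣≤∣i∣+∣j∣ i j)
∣i+j∣⊔∣i-j∣≡∣i∣+∣j∣ i@(+ _)      j@(-[1+ _ ]) = ⊔-≡ʳ refl (ℤ.∣i+j∣≤∣i∣+∣j∣ i j)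
∣i+j∣⊔∣i-j∣≡∣i∣+∣j∣ i@(-[1+ m ]) j@(+ k)      =
  ⊔-≡ʳ (trans (ℤ.∣i-j∣≡∣j-i∣ i j) (ℕ.+-comm k (suc m))) (ℤ.∣i+j∣≤∣i∣+∣j∣ i j)
∣i+j∣⊔∣i-j∣≡∣i∣+∣j∣ i@(-[1+ m ]) j@(-[1+ k ]) =
  ⊔-≡ˡ (cong suc (sym (ℕ.+-suc m k))) (ℤ.∣i-j∣≤∣i∣+∣j∣ i j)

rotate : ℤ² → ℤ²
rotate (x₁ , x₂) = x₁ + x₂ , x₁ - x₂

distℤ-rotate : ∀ u v → distℤ ℓ∞ (rotate u) (rotate v) ≡ distℤ ℓ₁ u v
distℤ-rotate (x₁ , x₂) (y₁ , y₂) = begin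
  + ℤ.∣ (x₁ + x₂) - (y₁ + y₂) ∣ ⊔ + ℤ.∣ (x₁ - x₂) - (y₁ - y₂) ∣
    ≡⟨ cong₂ (λ a b → + ℤ.∣ a ∣ ⊔ + ℤ.∣ b ∣) (sum-diff x₁ x₂ y₁ y₂) (diff-diff x₁ x₂ y₁ y₂) ⟩
  + ℤ.∣ a + b ∣ ⊔ + ℤ.∣ a - b ∣
    ≡⟨ cong +_ (∣i+j∣⊔∣i-j∣≡∣i∣+∣j∣ a b) ⟩
  + (ℤ.∣ a ∣ ℕ.+ ℤ.∣ b ∣)
    ≡⟨ ℤ.pos-+ ℤ.∣ a ∣ ℤ.∣ b ∣ ⟩
  + ℤ.∣ a ∣ + + ℤ.∣ b ∣ ∎
  where
  open ≡-Reasoning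
  a = x₁ - y₁
  b = x₂ - y₂
  sum-diff : ∀ x₁ x₂ y₁ y₂ → (x₁ + x₂) - (y₁ + y₂) ≡ (x₁ - y₁) + (x₂ - y₂)
  sum-diff = solve-∀
  diff-diff : ∀ x₁ x₂ y₁ y₂ → (x₁ - x₂) - (y₁ - y₂) ≡ (x₁ - y₁) - (x₂ - y₂)
  diff-diff = solve-∀

-- A voter at position v ∈ A ranks candidate k by the score S v k (smaller is better).
module Voting {n} {A : Set} (S : A → Fin n → ℤ) where

  Voter : Set
  Voter = Σ A λ v → Injective _≡_ _≡_ (S v)

  score : Voter → Fin n → ℤ
  score = S ∘ proj₁

  ranking : Voter → Ranking n
  ranking (v , S-injective) = RankBy.ranking (S v) S-injective

  profile : List Voter → Profile n
  profile L = record { m = length L ; voter = ranking ∘ lookup L }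

  vote : Voter → Fin n → Fin n → ℤ
  vote v i j = + indicator (score v i ℤ.<? score v j) - + indicator (score v j ℤ.<? score v i)

  margin : List Voter → Fin n → Fin n → ℤ
  margin []      i j = 0ℤ
  margin (v ∷ L) i j = vote v i j + margin L i j

  supporters-cons : ∀ v L i j →
    supporters (profile (v ∷ L)) i j ≡ indicator (score v i ℤ.<? score v j) ℕ.+ supporters (profile L) i j
  supporters-cons v L i j = trans
    (count-suc (λ k → (ranking (lookup (v ∷ L) k) ⟨$⟩ʳ i) Fin.<? (ranking (lookup (v ∷ L) k) ⟨$⟩ʳ j)))
    (cong (ℕ._+ supporters (profile L) i j) (indicator-cong (RankBy.prefers⇔ (S (proj₁ v)) (proj₂ v) i j) _ _))

  supporters-margin : ∀ L i j → + supporters (profile L) i j - + supporters (profile L) j i ≡ margin L i j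
  supporters-margin []      i j = refl
  supporters-margin (v ∷ L) i j = begin
    + supporters (profile (v ∷ L)) i j - + supporters (profile (v ∷ L)) j i
      ≡⟨ cong₂ (λ x y → + x - + y) (supporters-cons v L i j) (supporters-cons v L j i) ⟩
    + (a ℕ.+ sᵢⱼ) - + (b ℕ.+ sⱼᵢ)     ≡⟨ cong₂ _-_ (ℤ.pos-+ a sᵢⱼ) (ℤ.pos-+ b sⱼᵢ) ⟩
    (+ a + + sᵢⱼ) - (+ b + + sⱼᵢ)     ≡⟨ interchange (+ a) (+ b) (+ sᵢⱼ) (+ sⱼᵢ) ⟩
    vote v i j + (+ sᵢⱼ - + sⱼᵢ)      ≡⟨ cong (_+_ (vote v i j)) (supporters-margin L i j) ⟩
    margin (v ∷ L) i j                ∎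
    where
    open ≡-Reasoning
    a b sᵢⱼ sⱼᵢ : ℕ
    a   = indicator (score v i ℤ.<? score v j)
    b   = indicator (score v j ℤ.<? score v i)
    sᵢⱼ = supporters (profile L) i j
    sⱼᵢ = supporters (profile L) j i
    interchange : ∀ a b c d → (a + c) - (b + d) ≡ (a - b) + (c - d)
    interchange = solve-∀

  profile-induces : ∀ {T} L → (∀ i j → margin L i j ≡ w T i j) → Induces (profile L) T
  profile-induces L margin≡w i j = trans (sym (margin≡w i j)) (sym (supporters-margin L i j))

  vote-< : ∀ v {i j} → score v i < score v j → vote v i j ≡ 1ℤ
  vote-< v {i} {j} sᵢ<sⱼ with score v i ℤ.<? score v j | score v j ℤ.<? score v i
  ... | yes _ | no _      = refl
  ... | no ¬p | _         = contradiction sᵢ<sⱼ ¬p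
  ... | yes _ | yes sⱼ<sᵢ = contradiction sⱼ<sᵢ (ℤ.<-asym sᵢ<sⱼ)

  vote-> : ∀ v {i j} → score v j < score v i → vote v i j ≡ - 1ℤ
  vote-> v {i} {j} sⱼ<sᵢ with score v i ℤ.<? score v j | score v j ℤ.<? score v i
  ... | no _      | yes _ = refl
  ... | _         | no ¬p = contradiction sⱼ<sᵢ ¬p
  ... | yes sᵢ<sⱼ | yes _ = contradiction sⱼ<sᵢ (ℤ.<-asym sᵢ<sⱼ)

  vote-antisym : ∀ v i j → vote v j i ≡ - vote v i j
  vote-antisym v i j = swap (+ indicator (score v i ℤ.<? score v j)) (+ indicator (score v j ℤ.<? score v i))
    where
    swap : ∀ x y → y - x ≡ - (x - y)
    swap = solve-∀

  vote-±1 : ∀ v {i j} → i ≢ j → vote v i j ≡ 1ℤ ⊎ vote v i j ≡ - 1ℤ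
  vote-±1 v {i} {j} i≢j with ℤ.<-cmp (score v i) (score v j)
  ... | tri< sᵢ<sⱼ _ _ = inj₁ (vote-< v sᵢ<sⱼ)
  ... | tri≈ _ sᵢ≡sⱼ _ = contradiction (proj₂ v sᵢ≡sⱼ) i≢j
  ... | tri> _ _ sⱼ<sᵢ = inj₂ (vote-> v sⱼ<sᵢ)

  vote-opposed : ∀ v u {i j} → Opposed (score v) (score u) i j → vote v i j + vote u i j ≡ 0ℤ
  vote-opposed v u (i-first vᵢ<vⱼ uⱼ<uᵢ) = cong₂ _+_ (vote-< v vᵢ<vⱼ) (vote-> u uⱼ<uᵢ)
  vote-opposed v u (j-first vⱼ<vᵢ uᵢ<uⱼ) = cong₂ _+_ (vote-> v vⱼ<vᵢ) (vote-< u uᵢ<uⱼ)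

  margin-diagonal : ∀ L i → margin L i i ≡ 0ℤ
  margin-diagonal []      i = refl
  margin-diagonal (v ∷ L) i =
    cong₂ _+_ (ℤ.+-inverseʳ (+ indicator (score v i ℤ.<? score v i))) (margin-diagonal L i)

  margin-++ : ∀ L M i j → margin (L ++ M) i j ≡ margin L i j + margin M i j
  margin-++ []      M i j = sym (ℤ.+-identityˡ (margin M i j))
  margin-++ (v ∷ L) M i j = trans (cong (_+_ (vote v i j)) (margin-++ L M i j))
    (sym (ℤ.+-assoc (vote v i j) (margin L i j) (margin M i j)))

  margin-replicate : ∀ k L i j → margin (concat (replicate k L)) i j ≡ + k * margin L i j
  margin-replicate zero    L i j = sym (ℤ.*-zeroˡ (margin L i j))
  margin-replicate (suc k) L i j = begin
    margin (L ++ concat (replicate k L)) i j            ≡⟨ margin-++ L _ i j ⟩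
    margin L i j + margin (concat (replicate k L)) i j  ≡⟨ cong (_+_ (margin L i j)) (margin-replicate k L i j) ⟩
    margin L i j + + k * margin L i j                   ≡⟨ ℤ.suc-* (+ k) (margin L i j) ⟨
    + suc k * margin L i j                              ∎
    where open ≡-Reasoning

  margin-tabulate : ∀ {m} (f : Fin m → List Voter) i j →
    margin (concat (tabulate f)) i j ≡ sum (λ a → margin (f a) i j)
  margin-tabulate {zero}  f i j = refl
  margin-tabulate {suc m} f i j =
    trans (margin-++ (f zero) _ i j) (cong (_+_ (margin (f zero) i j)) (margin-tabulate (f ∘ suc) i j))

  record Realisation (p : Norm) : Set where
    field
      voter-point     : A → Point
      candidate-point : Fin n → Point
      dist≡S          : ∀ v k → dist p (voter-point v) (candidate-point k) ≡ fromℤ (S v k)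

  profile-euclidean : ∀ {p} → Realisation p → ∀ L → Euclidean2 p (profile L)
  profile-euclidean R L = candidate-point , voter-point ∘ proj₁ ∘ lookup L , λ k i j _ →
    let (v , S-injective) = lookup L k
        prefers⇔S = RankBy.prefers⇔ (S v) S-injective i j
        fromℤ⇔S   = fromℤ-<⇔ (S v i) (S v j)
    in mk⇔ (λ prefers → subst₂ ℚ._<_ (sym (dist≡S v i)) (sym (dist≡S v j))
                          (Equivalence.from fromℤ⇔S (Equivalence.to prefers⇔S prefers)))
           (λ closer → Equivalence.from prefers⇔S
                         (Equivalence.to fromℤ⇔S (subst₂ ℚ._<_ (dist≡S v i) (dist≡S v j) closer)))
    where open Realisation R

  inducible : ∀ {p T} → Realisation p → ∀ L → (∀ i j → margin L i j ≡ w T i j) → InducibleEuclidean p T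
  inducible {T = T} R L margin≡w = profile L , profile-induces {T} L margin≡w , profile-euclidean R L

  record Gadget (a b : Fin n) : Set where
    field
      first second   : A
      first-prefers  : S first a < S first b
      second-prefers : S second a < S second b
      opposed        : ∀ {i j} → i ≢ j → ¬ SamePair a b i j → Opposed (S first) (S second) i j

    voter₁ voter₂ : Voter
    voter₁ = first  , separating⇒injective (ℤ.<⇒≢ first-prefers)  λ i≢j ¬ab → opposed⇒≢ˡ (opposed i≢j ¬ab)
    voter₂ = second , separating⇒injective (ℤ.<⇒≢ second-prefers) λ i≢j ¬ab → opposed⇒≢ʳ (opposed i≢j ¬ab)

    voters : List Voter
    voters = voter₁ ∷ voter₂ ∷ []

    margin-forward : margin voters a b ≡ + 2
    margin-forward rewrite vote-< voter₁ first-prefers | vote-< voter₂ second-prefers = refl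

    margin-backward : margin voters b a ≡ - + 2
    margin-backward rewrite vote-> voter₁ first-prefers | vote-> voter₂ second-prefers = refl

    margin-elsewhere : ∀ {i j} → i ≢ j → ¬ SamePair a b i j → margin voters i j ≡ 0ℤ
    margin-elsewhere {i} {j} i≢j ¬ab = trans
      (cong (_+_ (vote voter₁ i j)) (ℤ.+-identityʳ (vote voter₂ i j)))
      (vote-opposed voter₁ voter₂ (opposed i≢j ¬ab))

  module _ {allowed : Fin n → Fin n → Set} (gadget : ∀ {a b} → allowed a b → Gadget a b) where

    gadgetCopies : ∀ {a b} (z : ℤ) → (z ≢ 0ℤ → allowed a b) → List Voter
    gadgetCopies (+ zero)         _       = []
    gadgetCopies {a} {b} +[1+ m ] support =
      concat (replicate (half⁺ +[1+ m ]) (Gadget.voters (gadget {a} {b} (support λ ()))))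
    gadgetCopies -[1+ _ ]         _       = []

    margin-gadgetCopies : ∀ {a b} z (support : z ≢ 0ℤ → allowed a b) {i j e} →
      (∀ (ab : allowed a b) → margin (Gadget.voters (gadget ab)) i j ≡ e) →
      margin (gadgetCopies z support) i j ≡ + half⁺ z * e
    margin-gadgetCopies (+ zero) _       {e = e} _        = sym (ℤ.*-zeroˡ e)
    margin-gadgetCopies +[1+ m ] support {i} {j} margin≡e =
      trans (margin-replicate (half⁺ +[1+ m ]) (Gadget.voters (gadget ab)) i j)
            (cong (_*_ (+ half⁺ +[1+ m ])) (margin≡e ab))
      where ab = support λ ()
    margin-gadgetCopies -[1+ _ ] _       {e = e} _        = sym (ℤ.*-zeroˡ e)

    even-margins : ∀ T → AllEven T → (∀ a b → w T a b ≢ 0ℤ → allowed a b) →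
      ∃ λ L → ∀ i j → margin L i j ≡ w T i j
    even-margins T even supported = L , margin-L
      where
      block : Fin n → Fin n → List Voter
      block a b = gadgetCopies (w T a b) (supported a b)

      L : List Voter
      L = concat (tabulate λ a → concat (tabulate (block a)))

      block-elsewhere : ∀ {i j} a b → i ≢ j → ¬ SamePair a b i j → margin (block a b) i j ≡ 0ℤ
      block-elsewhere a b i≢j ¬ab = trans
        (margin-gadgetCopies (w T a b) (supported a b) (λ ab → Gadget.margin-elsewhere (gadget ab) i≢j ¬ab))
        (ℤ.*-zeroʳ (+ half⁺ (w T a b)))

      margin-L : ∀ i j → margin L i j ≡ w T i j
      margin-L i j with i Fin.≟ j
      ... | yes refl = trans (margin-diagonal L i) (sym (w-diagonal T i))
      ... | no  i≢j  = begin
        margin L i j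
          ≡⟨ margin-tabulate (λ a → concat (tabulate (block a))) i j ⟩
        sum (λ a → margin (concat (tabulate (block a))) i j)
          ≡⟨ sum-cong-≗ (λ a → margin-tabulate (block a) i j) ⟩
        sum (λ a → sum (λ b → margin (block a b) i j))
          ≡⟨ sum-twoPoints _ i≢j (λ a a≢i a≢j → sum-zero _ λ b → block-elsewhere a b i≢j
               λ { (inj₁ (a≡i , _)) → a≢i a≡i ; (inj₂ (a≡j , _)) → a≢j a≡j }) ⟩
        sum (λ b → margin (block i b) i j) + sum (λ b → margin (block j b) i j)
          ≡⟨ cong₂ _+_
               (sum-pointMass _ j λ b b≢j → block-elsewhere i b i≢j
                 λ { (inj₁ (_ , b≡j)) → b≢j b≡j ; (inj₂ (i≡j , _)) → i≢j i≡j })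
               (sum-pointMass _ i λ b b≢i → block-elsewhere j b i≢j
                 λ { (inj₁ (j≡i , _)) → i≢j (sym j≡i) ; (inj₂ (_ , b≡i)) → b≢i b≡i }) ⟩
        margin (block i j) i j + margin (block j i) i j
          ≡⟨ cong₂ _+_ (margin-gadgetCopies (w T i j) (supported i j) (λ ab → Gadget.margin-forward (gadget ab)))
                       (margin-gadgetCopies (w T j i) (supported j i) (λ ab → Gadget.margin-backward (gadget ab))) ⟩
        + half⁺ (w T i j) * + 2 + + half⁺ (w T j i) * - + 2
          ≡⟨ cong (λ z → + half⁺ (w T i j) * + 2 + + half⁺ z * - + 2) (anti T i j) ⟩
        + half⁺ (w T i j) * + 2 + + half⁺ (- w T i j) * - + 2
          ≡⟨ half⁺-split (w T i j) (even i j) ⟩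
        w T i j ∎
        where open ≡-Reasoning

same-parity-margins : ∀ {n A} (S : A → Fin n → ℤ) → let open Voting S in
  (∀ {a b} → a ≢ b → Gadget a b) → ∀ T → SameParity T → ∃ λ L → ∀ i j → margin L i j ≡ w T i j
same-parity-margins {zero} S gadget T _ =
  Voting.even-margins S gadget T (λ ()) (nonzero⇒off-diagonal T)
same-parity-margins {suc zero} S gadget T _ =
  Voting.even-margins S gadget T (λ { zero zero → diagonal-even T zero }) (nonzero⇒off-diagonal T)
same-parity-margins {suc (suc n)} S gadget T same with even⊎odd (w T zero (suc zero))
... | inj₁ 2∣w₀₁ = even-margins gadget T all-even (nonzero⇒off-diagonal T)
  where
  open Voting S
  all-even : AllEven T
  all-even i j with i Fin.≟ j
  ... | yes refl = diagonal-even T i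
  ... | no  i≢j  = ∣⇒∣ᵤ (subst (+ 2 ∣_) (ℤ.+-identityʳ (w T i j))
    (same-parity-∣ T same {k = zero} {l = suc zero} i≢j (λ ()) 0ℤ (subst (+ 2 ∣_) (sym (ℤ.+-identityʳ _)) 2∣w₀₁)))
... | inj₂ 2∣w₀₁+1 = v₀ ∷ L , margin≡w
  where
  open Voting S
  -- Every weight is odd and every vote of v₀ is ± 1, so T₀ has even weights.
  v₀ : Voter
  v₀ = Gadget.voter₁ (gadget {zero} {suc zero} λ ())

  T₀ : WTournament (suc (suc n))
  T₀ = record { w = λ i j → w T i j - vote v₀ i j ; anti = anti₀ }
    where
    anti₀ : ∀ i j → w T j i - vote v₀ j i ≡ - (w T i j - vote v₀ i j)
    anti₀ i j rewrite anti T i j | vote-antisym v₀ i j = negate (w T i j) (vote v₀ i j)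
      where
      negate : ∀ x y → - x - - y ≡ - (x - y)
      negate = solve-∀

  T₀-even : AllEven T₀
  T₀-even i j with i Fin.≟ j
  ... | yes refl = diagonal-even T₀ i
  ... | no  i≢j  = ∣⇒∣ᵤ (odd-minus-±1 {w T i j}
    (same-parity-∣ T same {k = zero} {l = suc zero} i≢j (λ ()) 1ℤ 2∣w₀₁+1) (vote-±1 v₀ i≢j))

  residual : ∃ λ L → ∀ i j → margin L i j ≡ w T₀ i j
  residual = even-margins gadget T₀ T₀-even (nonzero⇒off-diagonal T₀)

  L : List Voter
  L = proj₁ residual

  margin≡w : ∀ i j → margin (v₀ ∷ L) i j ≡ w T i j
  margin≡w i j = trans (cong (_+_ (vote v₀ i j)) (proj₂ residual i j)) (cancel (vote v₀ i j) (w T i j))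
    where
    cancel : ∀ v x → v + (x - v) ≡ x
    cancel = solve-∀

plane-realisation : ∀ {n} p (cand : Fin n → ℤ²) → Voting.Realisation (λ v k → distℤ p v (cand k)) p
plane-realisation p cand = record
  { voter-point = fromℤ² ; candidate-point = fromℤ² ∘ cand ; dist≡S = λ v k → dist-fromℤ² p v (cand k) }

rotated-realisation : ∀ {n} (cand : Fin n → ℤ²) → Voting.Realisation (λ v k → distℤ ℓ₁ v (cand k)) ℓ∞
rotated-realisation cand = record
  { voter-point     = fromℤ² ∘ rotate
  ; candidate-point = fromℤ² ∘ rotate ∘ cand
  ; dist≡S          = λ v k →
      trans (dist-fromℤ² ℓ∞ (rotate v) (rotate (cand k))) (cong fromℤ (distℤ-rotate v (cand k)))
  }

2^-injective : ∀ {i j} → 2 ^ i ≡ 2 ^ j → i ≡ j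
2^-injective {i} {j} eq with ℕ.<-cmp i j
... | tri< i<j _ _ = contradiction eq (ℕ.<⇒≢ (ℕ.^-monoʳ-< 2 (ℕ.n<1+n 1) i<j))
... | tri≈ _ i≡j _ = i≡j
... | tri> _ _ j<i = contradiction (sym eq) (ℕ.<⇒≢ (ℕ.^-monoʳ-< 2 (ℕ.n<1+n 1) j<i))

2^i+2^j<2^k : ∀ {i j k} → i ℕ.< j → j ℕ.< k → 2 ^ i ℕ.+ 2 ^ j ℕ.< 2 ^ k
2^i+2^j<2^k {i} {j} {k} i<j j<k = begin-strict
  2 ^ i ℕ.+ 2 ^ j            <⟨ ℕ.+-monoˡ-< (2 ^ j) (ℕ.^-monoʳ-< 2 (ℕ.n<1+n 1) i<j) ⟩
  2 ^ j ℕ.+ 2 ^ j            ≡⟨ cong (2 ^ j ℕ.+_) (sym (ℕ.+-identityʳ (2 ^ j))) ⟩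
  2 ^ suc j                  ≤⟨ ℕ.^-monoʳ-≤ 2 j<k ⟩
  2 ^ k                      ∎
  where open ℕ.≤-Reasoning

pow : ∀ {n} → Fin n → ℕ
pow k = 2 ^ toℕ k

pow-injective : ∀ {n} → Injective _≡_ _≡_ (pow {n})
pow-injective = Fin.toℕ-injective ∘ 2^-injective

pow<2^n : ∀ {n} (k : Fin n) → pow k ℕ.< 2 ^ n
pow<2^n k = ℕ.^-monoʳ-< 2 (ℕ.n<1+n 1) (Fin.toℕ<n k)

-- The larger exponent is the only k with 2ᵏ ≤ 2ⁱ + 2ʲ < 2ᵏ⁺¹.
pow-sidon< : ∀ {n} {i j a b : Fin n} → i Fin.< j → a Fin.< b →
  pow i ℕ.+ pow j ≡ pow a ℕ.+ pow b → a ≡ i × b ≡ j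
pow-sidon< {i = i} {j} {a} {b} i<j a<b eq with Fin.<-cmp j b
... | tri< j<b _ _ = contradiction eq
  (ℕ.<⇒≢ (ℕ.<-≤-trans (2^i+2^j<2^k i<j j<b) (ℕ.m≤n+m (pow b) (pow a))))
... | tri> _ _ b<j = contradiction (sym eq)
  (ℕ.<⇒≢ (ℕ.<-≤-trans (2^i+2^j<2^k a<b b<j) (ℕ.m≤n+m (pow j) (pow i))))
... | tri≈ _ refl _ = sym (pow-injective (ℕ.+-cancelʳ-≡ (pow j) (pow i) (pow a) eq)) , refl

pow-sidon : ∀ {n} {i j a b : Fin n} → i ≢ j → a ≢ b →
  pow i ℕ.+ pow j ≡ pow a ℕ.+ pow b → SamePair a b i j
pow-sidon {i = i} {j} {a} {b} i≢j a≢b eq with Fin.<-cmp i j | Fin.<-cmp a b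
... | tri≈ _ i≡j _ | _              = contradiction i≡j i≢j
... | _            | tri≈ _ a≡b _   = contradiction a≡b a≢b
... | tri< i<j _ _ | tri< a<b _ _   = inj₁ (pow-sidon< i<j a<b eq)
... | tri< i<j _ _ | tri> _ _ b<a   =
  let b≡i , a≡j = pow-sidon< i<j b<a (trans eq (ℕ.+-comm (pow a) (pow b))) in inj₂ (a≡j , b≡i)
... | tri> _ _ j<i | tri< a<b _ _   =
  let a≡j , b≡i = pow-sidon< j<i a<b (trans (ℕ.+-comm (pow j) (pow i)) eq) in inj₂ (a≡j , b≡i)
... | tri> _ _ j<i | tri> _ _ b<a   =
  let b≡j , a≡i = pow-sidon< j<i b<a (trans (ℕ.+-comm (pow j) (pow i)) (trans eq (ℕ.+-comm (pow a) (pow b))))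
  in inj₁ (a≡i , b≡j)

x : ∀ {n} → Fin n → ℤ
x k = + pow k

x-injective : ∀ {n} → Injective _≡_ _≡_ (x {n})
x-injective = pow-injective ∘ ℤ.+-injective

x-sidon : ∀ {n} {i j a b : Fin n} → i ≢ j → a ≢ b → (x i + x j) - (x a + x b) ≡ 0ℤ → SamePair a b i j
x-sidon {i = i} {j} {a} {b} i≢j a≢b z≡0 = pow-sidon i≢j a≢b (ℤ.+-injective (begin
  + (pow i ℕ.+ pow j) ≡⟨ ℤ.pos-+ (pow i) (pow j) ⟩
  x i + x j           ≡⟨ ℤ.i-j≡0⇒i≡j (x i + x j) (x a + x b) z≡0 ⟩
  x a + x b           ≡⟨ ℤ.pos-+ (pow a) (pow b) ⟨
  + (pow a ℕ.+ pow b) ∎))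
  where open ≡-Reasoning

-- ℓ₂: candidates on a parabola

module Parabola (n : ℕ) where

  candidate : Fin n → ℤ²
  candidate k = x k , x k * x k

  S : ℤ² → Fin n → ℤ
  S v k = distℤ ℓ₂ v (candidate k)

  bracket : ℤ² → Fin n → Fin n → ℤ
  bracket (X , Y) i j = (1ℤ - + 2 * Y) * (x i + x j) + (x i + x j) * (x i * x i + x j * x j) - + 2 * X

  S-diff : ∀ v i j → S v i - S v j ≡ (x i - x j) * bracket v i j
  S-diff (X , Y) i j = factor X Y (x i) (x j)
    where
    factor : ∀ X Y a b →
      ((X - a) * (X - a) + (Y - a * a) * (Y - a * a)) - ((X - b) * (X - b) + (Y - b * b) * (Y - b * b))
      ≡ (a - b) * ((1ℤ - + 2 * Y) * (a + b) + (a + b) * (a * a + b * b) - + 2 * X)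
    factor = solve-∀

  F : Fin n → Fin n → ℤ
  F i j = (x i + x j) * (1ℤ + (x i * x i + x j * x j))

  B : ℤ
  B = + ((P ℕ.+ P) ℕ.* suc (P ℕ.* P ℕ.+ P ℕ.* P))
    where P = 2 ^ n

  F-bounds : ∀ i j → 0ℤ ≤ F i j × F i j < B
  F-bounds i j = subst (0ℤ ≤_) (sym F≡) (+≤+ z≤n) , subst (_< B) (sym F≡) (+<+ Fℕ<Bℕ)
    where
    a = pow i
    b = pow j
    F≡ : F i j ≡ + ((a ℕ.+ b) ℕ.* suc (a ℕ.* a ℕ.+ b ℕ.* b))
    F≡ = begin
      (x i + x j) * (1ℤ + (x i * x i + x j * x j))
        ≡⟨ cong (λ q → (x i + x j) * (1ℤ + q))
                (trans (ℤ.pos-+ (a ℕ.* a) _) (cong₂ _+_ (ℤ.pos-* a a) (ℤ.pos-* b b))) ⟨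
      (x i + x j) * (1ℤ + + (a ℕ.* a ℕ.+ b ℕ.* b))
        ≡⟨ cong₂ _*_ (ℤ.pos-+ a b) (ℤ.pos-+ 1 _) ⟨
      + (a ℕ.+ b) * + suc (a ℕ.* a ℕ.+ b ℕ.* b)
        ≡⟨ ℤ.pos-* (a ℕ.+ b) _ ⟨
      + ((a ℕ.+ b) ℕ.* suc (a ℕ.* a ℕ.+ b ℕ.* b)) ∎
      where open ≡-Reasoning
    a<P = pow<2^n i
    b<P = pow<2^n j
    Fℕ<Bℕ = ℕ.*-mono-< (ℕ.+-mono-< a<P b<P) (s≤s (ℕ.+-mono-< (ℕ.*-mono-< a<P a<P) (ℕ.*-mono-< b<P b<P)))

  0<B : 0ℤ < B
  0<B = +<+ (ℕ.*-mono-≤ (ℕ.+-mono-≤ (ℕ.m^n>0 2 n) z≤n) (s≤s z≤n))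

  -- Tie-breaking by ± B shifts F by at most 3 B, which stays below the dominant coefficient 4 B.
  shift-bounded : ∀ {f t} → 0ℤ ≤ f → f < B → t ≡ B ⊎ t ≡ - B → Bounded (+ 4 * B) (f - + 2 * t)
  shift-bounded {f} 0≤f f<B (inj₁ refl) =
    <-by-difference (f + + 2 * B) (lower f B) (ℤ.+-mono-≤-< 0≤f (*-pos-pos (ℤ.positive⁻¹ (+ 2)) 0<B)) ,
    <-by-difference ((B - f) + + 5 * B) (upper f B)
      (ℤ.+-mono-<-≤ (i<j⇒0<j-i f<B) (ℤ.<⇒≤ (*-pos-pos (ℤ.positive⁻¹ (+ 5)) 0<B)))
    where
    lower : ∀ f B → (f - + 2 * B) - - (+ 4 * B) ≡ f + + 2 * B
    lower = solve-∀
    upper : ∀ f B → + 4 * B - (f - + 2 * B) ≡ (B - f) + + 5 * B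
    upper = solve-∀
  shift-bounded {f} 0≤f f<B (inj₂ refl) =
    <-by-difference (f + + 6 * B) (lower f B) (ℤ.+-mono-≤-< 0≤f (*-pos-pos (ℤ.positive⁻¹ (+ 6)) 0<B)) ,
    <-by-difference ((B - f) + B) (upper f B) (ℤ.+-mono-<-≤ (i<j⇒0<j-i f<B) (ℤ.<⇒≤ 0<B))
    where
    lower : ∀ f B → (f - + 2 * - B) - - (+ 4 * B) ≡ f + + 6 * B
    lower = solve-∀
    upper : ∀ f B → + 4 * B - (f - + 2 * - B) ≡ (B - f) + B
    upper = solve-∀

  -- v₁ and v₂ are (t , 0) ± K (x a + x b , -1); that direction is normal to the chord
  -- from candidate a to candidate b.
  module ChordVoters (a b : Fin n) (t : ℤ) where

    K : ℤ
    K = + 2 * B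

    v₁ v₂ : ℤ²
    v₁ = K * (x a + x b) + t , - K
    v₂ = - (K * (x a + x b)) + t , K

    z g : Fin n → Fin n → ℤ
    z i j = (x i + x j) - (x a + x b)
    g i j = F i j - + 2 * t

    S-diff₁ : ∀ i j → S v₁ i - S v₁ j ≡ (x i - x j) * (+ 4 * B * z i j + g i j)
    S-diff₁ i j = trans (S-diff v₁ i j) (cong (_*_ (x i - x j)) (regroup B t (x a) (x b) (x i) (x j)))
      where
      regroup : ∀ B t xa xb xi xj →
        (1ℤ - + 2 * - (+ 2 * B)) * (xi + xj) + (xi + xj) * (xi * xi + xj * xj) - + 2 * (+ 2 * B * (xa + xb) + t)
        ≡ + 4 * B * ((xi + xj) - (xa + xb)) + ((xi + xj) * (1ℤ + (xi * xi + xj * xj)) - + 2 * t)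
      regroup = solve-∀

    S-diff₂ : ∀ i j → S v₂ i - S v₂ j ≡ (x i - x j) * (+ 4 * B * - z i j + g i j)
    S-diff₂ i j = trans (S-diff v₂ i j) (cong (_*_ (x i - x j)) (regroup B t (x a) (x b) (x i) (x j)))
      where
      regroup : ∀ B t xa xb xi xj →
        (1ℤ - + 2 * (+ 2 * B)) * (xi + xj) + (xi + xj) * (xi * xi + xj * xj) - + 2 * (- (+ 2 * B * (xa + xb)) + t)
        ≡ + 4 * B * - ((xi + xj) - (xa + xb)) + ((xi + xj) * (1ℤ + (xi * xi + xj * xj)) - + 2 * t)
      regroup = solve-∀

    dominant-vanishes : ∀ {ζ} → ζ ≡ 0ℤ → + 4 * B * ζ + g a b ≡ g a b
    dominant-vanishes refl = trans (cong (λ c → c + g a b) (ℤ.*-zeroʳ (+ 4 * B))) (ℤ.+-identityˡ (g a b))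

    gadget-with : a ≢ b → t ≡ B ⊎ t ≡ - B → OppositeSigns (x a - x b) (g a b) → Voting.Gadget S a b
    gadget-with a≢b t≡±B tie = record
      { first          = v₁
      ; second         = v₂
      ; first-prefers  = prefers {v₁} (S-diff₁ a b) (dominant-vanishes z≡0)
      ; second-prefers = prefers {v₂} (S-diff₂ a b) (dominant-vanishes (cong -_ z≡0))
      ; opposed        = λ {i} {j} i≢j ¬ab → opposite-signs⇒opposed
          (subst₂ OppositeSigns (sym (S-diff₁ i j)) (sym (S-diff₂ i j))
            (opposite-signs-*ˡ (x-diff≢0 i≢j)
              (opposite-signs-dominant 0≤4B (bounded i j) (bounded i j) (λ z≡0 → ¬ab (x-sidon i≢j a≢b z≡0)))))
      }
      where
      z≡0 : z a b ≡ 0ℤ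
      z≡0 = ℤ.+-inverseʳ (x a + x b)

      prefers : ∀ {v e} → S v a - S v b ≡ (x a - x b) * e → e ≡ g a b → S v a < S v b
      prefers diff refl = i-j<0⇒i<j (subst (_< 0ℤ) (sym diff) (opposite-signs⇒*<0 tie))

      x-diff≢0 : ∀ {i j} → i ≢ j → x i - x j ≢ 0ℤ
      x-diff≢0 i≢j xᵢ-xⱼ≡0 = i≢j (x-injective (ℤ.i-j≡0⇒i≡j _ _ xᵢ-xⱼ≡0))

      0≤4B : 0ℤ ≤ + 4 * B
      0≤4B = ℤ.<⇒≤ (*-pos-pos (ℤ.positive⁻¹ (+ 4)) 0<B)

      bounded : ∀ i j → Bounded (+ 4 * B) (g i j)
      bounded i j = shift-bounded (proj₁ (F-bounds i j)) (proj₂ (F-bounds i j)) t≡±B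

  tie-break : ∀ {f} → 0ℤ ≤ f → f < B → 0ℤ < f - + 2 * - B × f - + 2 * B < 0ℤ
  tie-break {f} 0≤f f<B =
    subst (0ℤ <_) (sym (push f B)) (ℤ.+-mono-≤-< 0≤f (*-pos-pos (ℤ.positive⁻¹ (+ 2)) 0<B)) ,
    <-by-difference ((B - f) + B) (pull f B) (ℤ.+-mono-<-≤ (i<j⇒0<j-i f<B) (ℤ.<⇒≤ 0<B))
    where
    push : ∀ f B → f - + 2 * - B ≡ f + + 2 * B
    push = solve-∀
    pull : ∀ f B → 0ℤ - (f - + 2 * B) ≡ (B - f) + B
    pull = solve-∀

  gadget : ∀ {a b} → a ≢ b → Voting.Gadget S a b
  gadget {a} {b} a≢b with ℤ.<-cmp (x a) (x b) | F-bounds a b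
  ... | tri< xₐ<x_b _ _ | 0≤F , F<B =
    ChordVoters.gadget-with a b (- B) a≢b (inj₂ refl) (inj₂ (i<j⇒i-j<0 xₐ<x_b , proj₁ (tie-break 0≤F F<B)))
  ... | tri≈ _ xₐ≡x_b _ | _ = contradiction (x-injective xₐ≡x_b) a≢b
  ... | tri> _ _ x_b<xₐ | 0≤F , F<B =
    ChordVoters.gadget-with a b B a≢b (inj₁ refl) (inj₁ (i<j⇒0<j-i x_b<xₐ , proj₂ (tie-break 0≤F F<B)))

-- ℓ₁ and ℓ∞: candidates on two vertical lines

module TwoLines {n} (side : Fin n → Bool) where

  P W : ℤ
  P = + 2 ^ n
  W = + 2 * P + 1ℤ

  column : Bool → ℤ
  column false = 0ℤ
  column true  = W

  candidate : Fin n → ℤ²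
  candidate k = column (side k) , + 2 * x k

  S : ℤ² → Fin n → ℤ
  S v k = distℤ ℓ₁ v (candidate k)

  reach : ℤ → Bool → ℤ
  reach X false = X
  reach X true  = W - X

  horizontal : ∀ {X} → 0ℤ ≤ X → X ≤ W → ∀ s → + ℤ.∣ X - column s ∣ ≡ reach X s
  horizontal {X} 0≤X X≤W false = trans (cong (λ d → + ℤ.∣ d ∣) (ℤ.+-identityʳ X)) (ℤ.0≤i⇒+∣i∣≡i 0≤X)
  horizontal {X} 0≤X X≤W true  = ℤ.∣-∣-≤ X≤W

  2x≤2P : ∀ k → + 2 * x k ≤ + 2 * P
  2x≤2P k = ℤ.*-monoˡ-≤-nonNeg (+ 2) {x k} {P} (ℤ.<⇒≤ (+<+ (pow<2^n {n} k)))

  S-top : ∀ {X} → 0ℤ ≤ X → X ≤ W → ∀ k → S (X , + 2 * P) k ≡ reach X (side k) + (+ 2 * P - + 2 * x k)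
  S-top 0≤X X≤W k = cong₂ _+_ (horizontal 0≤X X≤W (side k)) (ℤ.0≤i⇒+∣i∣≡i (ℤ.i≤j⇒0≤j-i (2x≤2P k)))

  S-bottom : ∀ {X} → 0ℤ ≤ X → X ≤ W → ∀ k → S (X , 0ℤ) k ≡ reach X (side k) + + 2 * x k
  S-bottom 0≤X X≤W k = cong₂ _+_ (horizontal 0≤X X≤W (side k))
    (trans (cong (λ d → + ℤ.∣ d ∣) (ℤ.+-identityˡ (- (+ 2 * x k))))
           (trans (cong +_ (ℤ.∣-i∣≡∣i∣ (+ 2 * x k))) (ℤ.0≤i⇒+∣i∣≡i (*-nonNeg {+ 2} {x k} (+≤+ z≤n) (+≤+ z≤n)))))

  in-strip : ∀ {δ} u w → 0ℤ ≤ δ → δ ≤ 1ℤ → 0ℤ ≤ P + δ - (x u - x w) × P + δ - (x u - x w) ≤ W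
  in-strip {δ} u w 0≤δ δ≤1 =
    subst (0ℤ ≤_) (sym (left P δ (x u) (x w))) (ℤ.+-mono-≤ (ℤ.+-mono-≤ (gap u) 0≤δ) (+≤+ z≤n)) ,
    ℤ.0≤i-j⇒j≤i (subst (0ℤ ≤_) (sym (right P δ (x u) (x w)))
      (ℤ.+-mono-≤ (ℤ.+-mono-≤ (gap w) (ℤ.i≤j⇒0≤j-i δ≤1)) (+≤+ z≤n)))
    where
    gap : ∀ k → 0ℤ ≤ P - x k
    gap k = ℤ.i≤j⇒0≤j-i (ℤ.<⇒≤ (+<+ (pow<2^n {n} k)))
    left : ∀ P δ a b → P + δ - (a - b) ≡ (P - a) + δ + b
    left = solve-∀
    right : ∀ P δ a b → (+ 2 * P + 1ℤ) - (P + δ - (a - b)) ≡ (P - b) + (1ℤ - δ) + a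
    right = solve-∀

  -- v₁ is above and v₂ below every candidate, so they disagree on same-side pairs. On a
  -- cross pair the horizontal distances contribute 2 X - W, chosen so that only (α , β)
  -- is balanced up to the tie-break 2 δ - 1.
  module CrossVoters (α β : Fin n) (α-left : side α ≡ false) (β-right : side β ≡ true)
                     (δ : ℤ) (0≤δ : 0ℤ ≤ δ) (δ≤1 : δ ≤ 1ℤ) where

    X₁ X₂ : ℤ
    X₁ = P + δ - (x β - x α)
    X₂ = P + δ - (x α - x β)

    v₁ v₂ : ℤ²
    v₁ = X₁ , + 2 * P
    v₂ = X₂ , 0ℤ

    S₁ : ∀ k → S v₁ k ≡ reach X₁ (side k) + (+ 2 * P - + 2 * x k)
    S₁ = S-top (proj₁ (in-strip β α 0≤δ δ≤1)) (proj₂ (in-strip β α 0≤δ δ≤1))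

    S₂ : ∀ k → S v₂ k ≡ reach X₂ (side k) + + 2 * x k
    S₂ = S-bottom (proj₁ (in-strip α β 0≤δ δ≤1)) (proj₂ (in-strip α β 0≤δ δ≤1))

    opposed-same-side : ∀ {i j} → i ≢ j → side i ≡ side j → Opposed (S v₁) (S v₂) i j
    opposed-same-side {i} {j} i≢j sᵢ≡sⱼ = opposite-signs⇒opposed
      (subst₂ OppositeSigns (sym diff₁) (sym diff₂)
        (opposite-signs-*ˡ (λ eq → i≢j (x-injective (ℤ.i-j≡0⇒i≡j _ _ eq))) (inj₂ (-<+ , ℤ.positive⁻¹ (+ 2)))))
      where
      diff₁ : S v₁ i - S v₁ j ≡ (x i - x j) * - + 2
      diff₁ rewrite S₁ i | S₁ j | sᵢ≡sⱼ = cancel (reach X₁ (side j)) (+ 2 * P) (x i) (x j)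
        where
        cancel : ∀ r Q a b → (r + (Q - + 2 * a)) - (r + (Q - + 2 * b)) ≡ (a - b) * - + 2
        cancel = solve-∀
      diff₂ : S v₂ i - S v₂ j ≡ (x i - x j) * + 2
      diff₂ rewrite S₂ i | S₂ j | sᵢ≡sⱼ = cancel (reach X₂ (side j)) (x i) (x j)
        where
        cancel : ∀ r a b → (r + + 2 * a) - (r + + 2 * b) ≡ (a - b) * + 2
        cancel = solve-∀

    z : Fin n → Fin n → ℤ
    z i j = (x j - x i) - (x β - x α)

    g : ℤ
    g = + 2 * δ - 1ℤ

    cross-diff₁ : ∀ {i j} → side i ≡ false → side j ≡ true → S v₁ i - S v₁ j ≡ + 2 * z i j + g
    cross-diff₁ {i} {j} sᵢ sⱼ rewrite S₁ i | S₁ j | sᵢ | sⱼ = regroup P δ (x α) (x β) (x i) (x j)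
      where
      regroup : ∀ P δ a b c d →
        (P + δ - (b - a) + (+ 2 * P - + 2 * c)) - ((+ 2 * P + 1ℤ - (P + δ - (b - a))) + (+ 2 * P - + 2 * d))
        ≡ + 2 * ((d - c) - (b - a)) + (+ 2 * δ - 1ℤ)
      regroup = solve-∀

    cross-diff₂ : ∀ {i j} → side i ≡ false → side j ≡ true → S v₂ i - S v₂ j ≡ + 2 * - z i j + g
    cross-diff₂ {i} {j} sᵢ sⱼ rewrite S₂ i | S₂ j | sᵢ | sⱼ = regroup P δ (x α) (x β) (x i) (x j)
      where
      regroup : ∀ P δ a b c d →
        (P + δ - (a - b) + + 2 * c) - ((+ 2 * P + 1ℤ - (P + δ - (a - b))) + + 2 * d)
        ≡ + 2 * - ((d - c) - (b - a)) + (+ 2 * δ - 1ℤ)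
      regroup = solve-∀

    g-bounded : Bounded (+ 2) g
    g-bounded =
      <-by-difference (+ 2 * δ + 1ℤ) (lower δ) (ℤ.+-mono-≤-< (*-nonNeg {+ 2} (+≤+ z≤n) 0≤δ) (ℤ.positive⁻¹ 1ℤ)) ,
      <-by-difference (+ 2 * (1ℤ - δ) + 1ℤ) (upper δ)
        (ℤ.+-mono-≤-< (*-nonNeg {+ 2} (+≤+ z≤n) (ℤ.i≤j⇒0≤j-i δ≤1)) (ℤ.positive⁻¹ 1ℤ))
      where
      lower : ∀ δ → (+ 2 * δ - 1ℤ) - - + 2 ≡ + 2 * δ + 1ℤ
      lower = solve-∀
      upper : ∀ δ → + 2 - (+ 2 * δ - 1ℤ) ≡ + 2 * (1ℤ - δ) + 1ℤ
      upper = solve-∀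

    opposed-cross : ∀ {i j} → side i ≡ false → side j ≡ true → ¬ SamePair α β i j → Opposed (S v₁) (S v₂) i j
    opposed-cross {i} {j} sᵢ sⱼ ¬αβ = opposite-signs⇒opposed
      (subst₂ OppositeSigns (sym (cross-diff₁ sᵢ sⱼ)) (sym (cross-diff₂ sᵢ sⱼ))
        (opposite-signs-dominant (+≤+ z≤n) g-bounded g-bounded z≢0))
      where
      different : ∀ {k l} → side k ≡ true → side l ≡ false → k ≢ l
      different sₖ sₗ refl with () ← trans (sym sₖ) sₗ
      z≢0 : z i j ≢ 0ℤ
      z≢0 z≡0 with x-sidon (different sⱼ α-left) (different β-right sᵢ)
                            (trans (regroup (x i) (x j) (x α) (x β)) z≡0)
        where
        regroup : ∀ a b c d → (b + c) - (d + a) ≡ (b - a) - (d - c)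
        regroup = solve-∀
      ... | inj₁ (β≡j , i≡α) = ¬αβ (inj₁ (sym i≡α , β≡j))
      ... | inj₂ (β≡α , _)   = different β-right α-left β≡α

    opposed : ∀ {i j} → i ≢ j → ¬ SamePair α β i j → Opposed (S v₁) (S v₂) i j
    opposed {i} {j} i≢j ¬αβ = by-sides (side i) (side j) refl refl
      where
      by-sides : ∀ sᵢ sⱼ → side i ≡ sᵢ → side j ≡ sⱼ → Opposed (S v₁) (S v₂) i j
      by-sides false true  eᵢ eⱼ = opposed-cross eᵢ eⱼ ¬αβ
      by-sides true  false eᵢ eⱼ = opposed-sym (opposed-cross eⱼ eᵢ (¬αβ ∘ SamePair-swapʳ))
      by-sides false false eᵢ eⱼ = opposed-same-side i≢j (trans eᵢ (sym eⱼ))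
      by-sides true  true  eᵢ eⱼ = opposed-same-side i≢j (trans eᵢ (sym eⱼ))

    tie₁ : S v₁ α - S v₁ β ≡ g
    tie₁ = trans (cross-diff₁ α-left β-right)
      (trans (cong (λ ζ → + 2 * ζ + g) (ℤ.+-inverseʳ (x β - x α))) (ℤ.+-identityˡ g))

    tie₂ : S v₂ α - S v₂ β ≡ g
    tie₂ = trans (cross-diff₂ α-left β-right)
      (trans (cong (λ ζ → + 2 * - ζ + g) (ℤ.+-inverseʳ (x β - x α))) (ℤ.+-identityˡ g))

  gadget : ∀ {a b} → side a ≢ side b → Voting.Gadget S a b
  gadget {a} {b} sₐ≢s_b with side a in sₐ | side b in s_b
  ... | false | true  = record
    { first = v₁ ; second = v₂
    ; first-prefers  = i-j<0⇒i<j (subst (_< 0ℤ) (sym tie₁) -<+)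
    ; second-prefers = i-j<0⇒i<j (subst (_< 0ℤ) (sym tie₂) -<+)
    ; opposed        = opposed
    }
    where open CrossVoters a b sₐ s_b 0ℤ (+≤+ z≤n) (+≤+ z≤n)
  ... | true  | false = record
    { first = v₁ ; second = v₂
    ; first-prefers  = 0<i-j⇒j<i (subst (0ℤ <_) (sym tie₁) (ℤ.positive⁻¹ 1ℤ))
    ; second-prefers = 0<i-j⇒j<i (subst (0ℤ <_) (sym tie₂) (ℤ.positive⁻¹ 1ℤ))
    ; opposed        = λ i≢j ¬ab → opposed i≢j (¬ab ∘ SamePair-swapˡ)
    }
    where open CrossVoters b a s_b sₐ 1ℤ (+≤+ z≤n) (+≤+ (s≤s z≤n))
  ... | false | false = contradiction refl sₐ≢s_b
  ... | true  | true  = contradiction refl sₐ≢s_b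

theorem2 : (∀ (n : ℕ) (T : WTournament n) → SameParity T → InducibleEuclidean ℓ₂ T)
    × (∀ (n : ℕ) (T : WTournament n) → Bipartite T → AllEven T →
         InducibleEuclidean ℓ₁ T × InducibleEuclidean ℓ∞ T)
theorem2 = ℓ₂-inducible , ℓ₁-ℓ∞-inducible
  where
  ℓ₂-inducible : ∀ n (T : WTournament n) → SameParity T → InducibleEuclidean ℓ₂ T
  ℓ₂-inducible n T same =
    let L , margin≡w = same-parity-margins S gadget T same
    in  inducible {T = T} (plane-realisation ℓ₂ candidate) L margin≡w
    where
    open Parabola n
    open Voting S using (inducible)

  ℓ₁-ℓ∞-inducible : ∀ n (T : WTournament n) → Bipartite T → AllEven T →
    InducibleEuclidean ℓ₁ T × InducibleEuclidean ℓ∞ T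
  ℓ₁-ℓ∞-inducible n T (side , bipartite) even =
    let L , margin≡w = even-margins gadget T even bipartite
    in  inducible {T = T} (plane-realisation ℓ₁ candidate) L margin≡w ,
        inducible {T = T} (rotated-realisation candidate) L margin≡w
    where
    open TwoLines side
    open Voting S using (inducible; even-margins)
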